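{- For all positive integers $n$ and $k$, \[ R(n,k) = a(1,n-k) - a(1,n-2k). \]
   Context: A composition of $n$ is a finite sequence of positive integers summing to $n$. A run in a composition is a maximal block of consecutive equal parts. $R(n,k)$ denotes the total number of runs consisting of the part $k$ (of any length) over all compositions of $n$. For integers $N\ge0$, $a(1,N)$ is the number of tilings of a $1\times(N+1)$ grid by one red $1\times1$ square and white tiles of arbitrary positive integer lengths of total length $N$ (order matters); $a(1,N)=0$ for $N<0$. -}

module Defs where

open import Data.Nat using (ℕ; zero; suc; _+_; _≟_)
open import Data.Integer using (ℤ; +_; -[1+_])
open import Data.List using (List; []; _∷_; map; concatMap; upTo; filter; length)
open import Data.Nat.ListAction using (sum)
open import Data.Maybe using (Maybe; just; nothing)
open import Data.Bool using (Bool; true; false; if_then_else_)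
open import Relation.Nullary.Decidable using (⌊_⌋)

listsOf : {A : Set} → List A → ℕ → List (List A)
listsOf xs zero    = [] ∷ []
listsOf xs (suc ℓ) = concatMap (λ x → map (x ∷_) (listsOf xs ℓ)) xs

listsUpTo : {A : Set} → List A → ℕ → List (List A)
listsUpTo xs m = concatMap (listsOf xs) (upTo (suc m))

-- Compositions of n: sequences of positive integers summing to n.
-- (Every composition of n has at most n parts, each in 1..n.)

compositions : ℕ → List (List ℕ)
compositions n = filter (λ c → sum c ≟ n) (listsUpTo (map suc (upTo n)) n)

-- Number of runs (maximal blocks of consecutive equal parts) consisting
-- of the part k: count positions holding k whose predecessor is not k.
runsFrom : ℕ → Maybe ℕ → List ℕ → ℕ
runsFrom k prev [] = 0
runsFrom k prev (x ∷ xs) = newRun prev + runsFrom k (just x) xs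
  where
  isK : ℕ → ℕ
  isK y = if ⌊ y ≟ k ⌋ then 1 else 0
  newRun : Maybe ℕ → ℕ
  newRun nothing  = isK x
  newRun (just p) = if ⌊ p ≟ k ⌋ then 0 else isK x

runs : ℕ → List ℕ → ℕ
runs k c = runsFrom k nothing c

R : ℕ → ℕ → ℕ
R n k = sum (map (runs k) (compositions n))

-- Tilings of a 1×M board by red 1×1 squares and white tiles of
-- positive integer length.

data Tile : Set where
  red   : Tile
  white : ℕ → Tile     -- white ℓ has length ℓ (enumerated with ℓ ≥ 1)

tileLength : Tile → ℕ
tileLength red       = 1
tileLength (white ℓ) = ℓ

isRed : Tile → ℕ
isRed red       = 1
isRed (white _) = 0

totalLength : List Tile → ℕ
totalLength ts = sum (map tileLength ts)

redCount : List Tile → ℕ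
redCount ts = sum (map isRed ts)

tilesFor : ℕ → List Tile
tilesFor M = red ∷ map (λ ℓ → white (suc ℓ)) (upTo M)

-- tilings of a 1×(N+1) board using exactly one red square
-- (so the white tiles have total length N)
tilings1 : ℕ → List (List Tile)
tilings1 N = filter (λ t → redCount t ≟ 1)
               (filter (λ t → totalLength t ≟ suc N)
                 (listsUpTo (tilesFor (suc N)) (suc N)))

a1ℕ : ℕ → ℕ
a1ℕ N = length (tilings1 N)

a1 : ℤ → ℕ
a1 (+ N)    = a1ℕ N
a1 -[1+ _ ] = 0

module Submission where

-- Write Σ< s P for P 0 + ... + P (s-1).  A sequence P "solves" the
-- recurrence with inhomogeneity e if P s = e s + Σ< s P for every s; such
-- a P is determined by e, and delaying both P and e by j steps (shift j)
-- preserves the property.  Both compositions and tilings are words over a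
-- weighted alphabet, and the module WordSums shows, for the brute-force
-- enumerations of Defs, that sums over the words of weight s split by the
-- first letter.  With C s the number of compositions of s this gives
--   * C solves the recurrence with inhomogeneity [s = 0];
--   * a(1,·) solves it with inhomogeneity C (split tilings by their first tile);
--   * A s = R(s,k) satisfies  A s + shift (2k) C s = shift k C s + Σ< s A,
--     because a part equal to k starts a new run unless it follows a k.
-- Hence A + shift (2k) a(1,·) and shift k a(1,·) solve the same recurrence,
-- so they coincide; subtracting gives the theorem.

open import Defs
open import Data.Nat using (ℕ; zero; suc; _+_; _∸_; _≤_; _<_; _≟_; _≤?_; z≤n; s≤s; NonZero)
open import Data.Nat.Properties
  using (+-assoc; +-comm; +-identityʳ; +-commutativeSemigroup; ≤-refl; ≤-trans; n≤1+n;
         m∸n≤m; ∸-monoʳ-≤; ∸-monoˡ-≤; m≤n+m; m≤m+n; m+n∸n≡m; m+n∸m≡n; m+[n∸m]≡n; 0≢1+n; n≮0)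
open import Data.Nat.Induction using (<-rec)
open import Data.Nat.ListAction using (sum)
open import Data.Nat.ListAction.Properties using (sum-++)
open import Data.Integer using (+_; _-_; _*_; _⊖_)
import Data.Integer.Properties as ℤ
open import Data.List using (List; []; _∷_; map; concatMap; applyUpTo; upTo; filter; length; _++_)
open import Data.List.Properties using (map-++; map-cong; map-∘)
open import Data.List.Relation.Unary.All as All using (All)
open import Data.Bool using (true; false; if_then_else_)
open import Data.Bool.Properties using (if-swap-then; if-eta)
open import Data.Maybe using (just)
open import Relation.Nullary using (Dec; does; yes; no; ¬_)
open import Relation.Nullary.Decidable using (dec-true; dec-false; isYes≗does; does-⇔)
open import Function.Bundles using (mk⇔)
open import Relation.Binary.PropositionalEquality
  using (_≡_; refl; sym; trans; cong; cong₂; subst; module ≡-Reasoning)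
open import Algebra.Properties.CommutativeSemigroup +-commutativeSemigroup using (interchange)

open ≡-Reasoning

if-yes : ∀ {P : Set} (d : Dec P) {a b : ℕ} → P → (if does d then a else b) ≡ a
if-yes d p rewrite dec-true d p = refl

if-no : ∀ {P : Set} (d : Dec P) {a b : ℕ} → ¬ P → (if does d then a else b) ≡ b
if-no d ¬p rewrite dec-false d ¬p = refl

if-cong : ∀ {P : Set} (d : Dec P) {a b : ℕ} → (P → a ≡ b) →
          (if does d then a else 0) ≡ (if does d then b else 0)
if-cong (yes p) eq = eq p
if-cong (no _)  eq = refl

if-+ : ∀ b x y → (if b then x + y else 0) ≡ (if b then x else 0) + (if b then y else 0)
if-+ true  x y = refl
if-+ false x y = refl

-- Finite sums  Σ< n f = f 0 + ... + f (n - 1), peeling off the first term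
-- so that re-indexing j ↦ j + 1 is definitional.
Σ< : ℕ → (ℕ → ℕ) → ℕ
Σ< zero    f = 0
Σ< (suc n) f = f 0 + Σ< n (λ j → f (suc j))

Σ<-cong : ∀ n {f g : ℕ → ℕ} → (∀ j → j < n → f j ≡ g j) → Σ< n f ≡ Σ< n g
Σ<-cong zero    eq = refl
Σ<-cong (suc n) eq = cong₂ _+_ (eq 0 (s≤s z≤n)) (Σ<-cong n (λ j j<n → eq (suc j) (s≤s j<n)))

Σ<-zero : ∀ n → Σ< n (λ _ → 0) ≡ 0
Σ<-zero zero    = refl
Σ<-zero (suc n) = Σ<-zero n

Σ<-+ : ∀ n (f g : ℕ → ℕ) → Σ< n (λ j → f j + g j) ≡ Σ< n f + Σ< n g
Σ<-+ zero    f g = refl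
Σ<-+ (suc n) f g =
  trans (cong (λ t → f 0 + g 0 + t) (Σ<-+ n _ _)) (interchange (f 0) (g 0) _ _)

Σ<-if : ∀ n b (f : ℕ → ℕ) → Σ< n (λ j → if b then f j else 0) ≡ (if b then Σ< n f else 0)
Σ<-if n true  f = refl
Σ<-if n false f = Σ<-zero n

Σ<-last : ∀ n (f : ℕ → ℕ) → Σ< (suc n) f ≡ Σ< n f + f n
Σ<-last zero    f = +-comm (f 0) 0
Σ<-last (suc n) f =
  trans (cong (_+_ (f 0)) (Σ<-last n (λ j → f (suc j)))) (sym (+-assoc (f 0) _ _))

Σ<-reverse : ∀ n (f : ℕ → ℕ) → Σ< (suc n) (λ j → f (n ∸ j)) ≡ Σ< (suc n) f
Σ<-reverse zero    f = refl
Σ<-reverse (suc n) f = begin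
  f (suc n) + Σ< (suc n) (λ j → f (n ∸ j)) ≡⟨ cong (_+_ (f (suc n))) (Σ<-reverse n f) ⟩
  f (suc n) + Σ< (suc n) f                 ≡⟨ +-comm (f (suc n)) _ ⟩
  Σ< (suc n) f + f (suc n)                 ≡⟨ Σ<-last (suc n) f ⟨
  Σ< (suc (suc n)) f                       ∎

Σ<-truncate : ∀ {s M} → s ≤ M → ∀ (f : ℕ → ℕ) →
              Σ< M (λ j → if does (suc j ≤? s) then f j else 0) ≡ Σ< s f
Σ<-truncate {zero}  {M}     z≤n       f = Σ<-zero M
Σ<-truncate {suc s} {suc M} (s≤s s≤M) f = cong (_+_ (f 0)) (Σ<-truncate s≤M (λ j → f (suc j)))

shift : ℕ → (ℕ → ℕ) → ℕ → ℕ
shift zero    f s       = f s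
shift (suc j) f zero    = 0
shift (suc j) f (suc s) = shift j f s

shift-shift : ∀ i j (f : ℕ → ℕ) s → shift i (shift j f) s ≡ shift (i + j) f s
shift-shift zero    j f s       = refl
shift-shift (suc i) j f zero    = refl
shift-shift (suc i) j f (suc s) = shift-shift i j f s

Σ<-pick : ∀ i s (f : ℕ → ℕ) →
          Σ< (suc s) (λ j → if does (j ≟ i) then f (s ∸ j) else 0) ≡ shift i f s
Σ<-pick zero    s       f = trans (cong (_+_ (f s)) (Σ<-zero s)) (+-identityʳ (f s))
Σ<-pick (suc i) zero    f = refl
Σ<-pick (suc i) (suc s) f = Σ<-pick i s f

Solves : (ℕ → ℕ) → (ℕ → ℕ) → Set
Solves e P = ∀ s → P s ≡ e s + Σ< s P

solution-unique : ∀ {e P Q : ℕ → ℕ} → Solves e P → Solves e Q → ∀ s → P s ≡ Q s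
solution-unique {e} {P} {Q} hP hQ = <-rec (λ s → P s ≡ Q s) λ s below →
  trans (hP s) (trans (cong (_+_ (e s)) (Σ<-cong s (λ j j<s → below j<s))) (sym (hQ s)))

solves-shift : ∀ j {e P : ℕ → ℕ} → Solves e P → Solves (shift j e) (shift j P)
solves-shift zero    hP         = hP
solves-shift (suc j) hP zero    = refl
solves-shift (suc j) hP (suc s) = solves-shift j hP s

sum-map-++ : ∀ {A : Set} (F : A → ℕ) l l′ → sum (map F (l ++ l′)) ≡ sum (map F l) + sum (map F l′)
sum-map-++ F l l′ = trans (cong sum (map-++ F l l′)) (sum-++ (map F l) (map F l′))

module _ {A : Set} where

  sum-map-cong : ∀ {F G : A → ℕ} (l : List A) → (∀ x → F x ≡ G x) →
                 sum (map F l) ≡ sum (map G l)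
  sum-map-cong l eq = cong sum (map-cong eq l)

  sum-map-cong-All : ∀ {F G : A → ℕ} {l : List A} → All (λ x → F x ≡ G x) l →
                     sum (map F l) ≡ sum (map G l)
  sum-map-cong-All All.[]         = refl
  sum-map-cong-All (eq All.∷ eqs) = cong₂ _+_ eq (sum-map-cong-All eqs)

  sum-map-zero : (l : List A) → sum (map (λ _ → 0) l) ≡ 0
  sum-map-zero []      = refl
  sum-map-zero (x ∷ l) = sum-map-zero l

  sum-map-+ : ∀ (F G : A → ℕ) l → sum (map (λ x → F x + G x) l) ≡ sum (map F l) + sum (map G l)
  sum-map-+ F G []      = refl
  sum-map-+ F G (x ∷ l) =
    trans (cong (λ t → F x + G x + t) (sum-map-+ F G l)) (interchange (F x) (G x) _ _)

  sum-map-if : ∀ b (F : A → ℕ) l → sum (map (λ x → if b then F x else 0) l) ≡ (if b then sum (map F l) else 0)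
  sum-map-if true  F l = refl
  sum-map-if false F l = sum-map-zero l

  sum-map-filter : ∀ {P : A → Set} (P? : ∀ x → Dec (P x)) (F : A → ℕ) l →
                   sum (map F (filter P? l)) ≡ sum (map (λ x → if does (P? x) then F x else 0) l)
  sum-map-filter P? F []      = refl
  sum-map-filter P? F (x ∷ l) with does (P? x)
  ... | true  = cong (_+_ (F x)) (sum-map-filter P? F l)
  ... | false = sum-map-filter P? F l

  sum-map-concatMap : ∀ {B : Set} (F : B → ℕ) (G : A → List B) l →
                      sum (map F (concatMap G l)) ≡ sum (map (λ x → sum (map F (G x))) l)
  sum-map-concatMap F G []      = refl
  sum-map-concatMap F G (x ∷ l) =
    trans (sum-map-++ F (G x) (concatMap G l)) (cong (_+_ (sum (map F (G x)))) (sum-map-concatMap F G l))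

  length-as-sum : (l : List A) → length l ≡ sum (map (λ _ → 1) l)
  length-as-sum []      = refl
  length-as-sum (x ∷ l) = cong suc (length-as-sum l)

  Σ<-sum-swap : ∀ n (F : A → ℕ → ℕ) l →
                Σ< n (λ j → sum (map (λ x → F x j) l)) ≡ sum (map (λ x → Σ< n (F x)) l)
  Σ<-sum-swap zero    F l = sym (sum-map-zero l)
  Σ<-sum-swap (suc n) F l = begin
    sum (map (λ x → F x 0) l) + Σ< n (λ j → sum (map (λ x → F x (suc j)) l))
      ≡⟨ cong (_+_ (sum (map (λ x → F x 0) l))) (Σ<-sum-swap n (λ x j → F x (suc j)) l) ⟩
    sum (map (λ x → F x 0) l) + sum (map (λ x → Σ< n (λ j → F x (suc j))) l)
      ≡⟨ sum-map-+ (λ x → F x 0) (λ x → Σ< n (λ j → F x (suc j))) l ⟨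
    sum (map (λ x → Σ< (suc n) (F x)) l) ∎

sum-map-applyUpTo : ∀ {A : Set} (F : A → ℕ) (f : ℕ → A) n → sum (map F (applyUpTo f n)) ≡ Σ< n (λ j → F (f j))
sum-map-applyUpTo F f zero    = refl
sum-map-applyUpTo F f (suc n) = cong (_+_ (F (f 0))) (sum-map-applyUpTo F (λ j → f (suc j)) n)

weight-drop : ∀ {s m v} → s ≤ suc m → 1 ≤ v → s ∸ v ≤ m
weight-drop {s} s≤1+m 1≤v = ≤-trans (∸-monoʳ-≤ s 1≤v) (∸-monoˡ-≤ 1 s≤1+m)

-- Sums over words of a given weight

module WordSums {A : Set} (w : A → ℕ) (W : List A → ℕ)
                (W-[] : W [] ≡ 0) (W-∷ : ∀ x c → W (x ∷ c) ≡ w x + W c) where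

  atWeight : ℕ → (List A → ℕ) → List A → ℕ
  atWeight s g c = if does (W c ≟ s) then g c else 0

  atWeight-∷ : ∀ s g x c → atWeight s g (x ∷ c) ≡
               (if does (w x ≤? s) then atWeight (s ∸ w x) (λ l → g (x ∷ l)) c else 0)
  atWeight-∷ s g x c with w x ≤? s
  ... | yes wx≤s = trans (cong (λ b → if b then g (x ∷ c) else 0)
                               (does-⇔ (mk⇔ drop-first add-first) (W (x ∷ c) ≟ s) (W c ≟ s ∸ w x)))
                        (sym (if-yes (w x ≤? s) wx≤s))
    where
    drop-first : W (x ∷ c) ≡ s → W c ≡ s ∸ w x
    drop-first e = trans (sym (m+n∸m≡n (w x) (W c))) (cong (_∸ w x) (trans (sym (W-∷ x c)) e))
    add-first : W c ≡ s ∸ w x → W (x ∷ c) ≡ s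
    add-first e = trans (W-∷ x c) (trans (cong (_+_ (w x)) e) (m+[n∸m]≡n wx≤s))
  ... | no wx≰s = trans (if-no (W (x ∷ c) ≟ s) (λ e → wx≰s (subst (w x ≤_) (trans (sym (W-∷ x c)) e) (m≤m+n (w x) (W c)))))
                       (sym (if-no (w x ≤? s) wx≰s))

  atWeight-+ : ∀ s g g′ c → atWeight s (λ l → g l + g′ l) c ≡ atWeight s g c + atWeight s g′ c
  atWeight-+ s g g′ c = if-+ (does (W c ≟ s)) (g c) (g′ c)

  atWeight-if : ∀ s b g c → atWeight s (λ l → if b then g l else 0) c ≡ (if b then atWeight s g c else 0)
  atWeight-if s b g c = if-swap-then (does (W c ≟ s)) b

  wsumLen : List A → ℕ → ℕ → (List A → ℕ) → ℕ
  wsumLen xs ℓ s g = sum (map (atWeight s g) (listsOf xs ℓ))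

  wsum : List A → ℕ → ℕ → (List A → ℕ) → ℕ
  wsum xs m s g = sum (map (atWeight s g) (listsUpTo xs m))

  firstAtMost : ℕ → (A → ℕ) → A → ℕ
  firstAtMost s G x = if does (w x ≤? s) then G x else 0

  wsumLen-suc : ∀ xs ℓ s g → wsumLen xs (suc ℓ) s g ≡
                sum (map (firstAtMost s (λ x → wsumLen xs ℓ (s ∸ w x) (λ l → g (x ∷ l)))) xs)
  wsumLen-suc xs ℓ s g =
    trans (sum-map-concatMap (atWeight s g) (λ x → map (x ∷_) (listsOf xs ℓ)) xs)
          (sum-map-cong xs λ x → begin
            sum (map (atWeight s g) (map (x ∷_) (listsOf xs ℓ)))
              ≡⟨ cong sum (map-∘ (listsOf xs ℓ)) ⟨
            sum (map (λ c → atWeight s g (x ∷ c)) (listsOf xs ℓ))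
              ≡⟨ sum-map-cong (listsOf xs ℓ) (atWeight-∷ s g x) ⟩
            sum (map (λ c → if does (w x ≤? s) then atWeight (s ∸ w x) (λ l → g (x ∷ l)) c else 0) (listsOf xs ℓ))
              ≡⟨ sum-map-if (does (w x ≤? s)) _ (listsOf xs ℓ) ⟩
            firstAtMost s (λ x → wsumLen xs ℓ (s ∸ w x) (λ l → g (x ∷ l))) x ∎)

  wsum-by-length : ∀ xs m s g → wsum xs m s g ≡ Σ< (suc m) (λ ℓ → wsumLen xs ℓ s g)
  wsum-by-length xs m s g =
    trans (sum-map-concatMap (atWeight s g) (listsOf xs) (upTo (suc m)))
          (sum-map-applyUpTo (λ ℓ → wsumLen xs ℓ s g) (λ j → j) (suc m))

  wsum-suc : ∀ xs m s g → wsum xs (suc m) s g ≡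
             atWeight s g [] + sum (map (firstAtMost s (λ x → wsum xs m (s ∸ w x) (λ l → g (x ∷ l)))) xs)
  wsum-suc xs m s g = begin
    wsum xs (suc m) s g
      ≡⟨ wsum-by-length xs (suc m) s g ⟩
    (atWeight s g [] + 0) + Σ< (suc m) (λ ℓ → wsumLen xs (suc ℓ) s g)
      ≡⟨ cong₂ _+_ (+-identityʳ (atWeight s g [])) (Σ<-cong (suc m) (λ ℓ _ → wsumLen-suc xs ℓ s g)) ⟩
    atWeight s g [] + Σ< (suc m) (λ ℓ → sum (map (λ x → firstAtMost s (rest ℓ) x) xs))
      ≡⟨ cong (_+_ (atWeight s g [])) (Σ<-sum-swap (suc m) (λ x ℓ → firstAtMost s (rest ℓ) x) xs) ⟩
    atWeight s g [] + sum (map (λ x → Σ< (suc m) (λ ℓ → firstAtMost s (rest ℓ) x)) xs)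
      ≡⟨ cong (_+_ (atWeight s g [])) (sum-map-cong xs λ x →
           trans (Σ<-if (suc m) (does (w x ≤? s)) (λ ℓ → rest ℓ x))
                 (cong (if does (w x ≤? s) then_else 0) (sym (wsum-by-length xs m (s ∸ w x) _)))) ⟩
    atWeight s g [] + sum (map (firstAtMost s (λ x → wsum xs m (s ∸ w x) (λ l → g (x ∷ l)))) xs) ∎
    where
    rest : ℕ → A → ℕ
    rest ℓ x = wsumLen xs ℓ (s ∸ w x) (λ l → g (x ∷ l))

  atWeight-zero-[] : ∀ g → atWeight 0 g [] ≡ g []
  atWeight-zero-[] g = if-yes (W [] ≟ 0) W-[]

  atWeight-suc-[] : ∀ s g → atWeight (suc s) g [] ≡ 0
  atWeight-suc-[] s g = if-no (W [] ≟ suc s) (λ e → 0≢1+n (trans (sym W-[]) e))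

  module Alphabet (pre : List A) (letter : ℕ → A) (w-letter : ∀ j → w (letter j) ≡ j)
                  (pre-positive : All (λ x → 1 ≤ w x) pre) where

    alphabet : ℕ → List A
    alphabet M = pre ++ map (λ j → letter (suc j)) (upTo M)

    preSum : ℕ → (A → ℕ) → ℕ
    preSum s G = sum (map (firstAtMost s G) pre)

    firstAtMost-alphabet : ∀ {s M} → s ≤ M → ∀ G →
      sum (map (firstAtMost s G) (alphabet M)) ≡ preSum s G + Σ< s (λ j → G (letter (suc j)))
    firstAtMost-alphabet {s} {M} s≤M G = begin
      sum (map (firstAtMost s G) (alphabet M))
        ≡⟨ sum-map-++ (firstAtMost s G) pre _ ⟩
      preSum s G + sum (map (firstAtMost s G) (map (λ j → letter (suc j)) (upTo M)))
        ≡⟨ cong (_+_ (preSum s G)) (cong sum (map-∘ (upTo M))) ⟨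
      preSum s G + sum (map (λ j → firstAtMost s G (letter (suc j))) (upTo M))
        ≡⟨ cong (_+_ (preSum s G)) (sum-map-applyUpTo (λ j → firstAtMost s G (letter (suc j))) (λ j → j) M) ⟩
      preSum s G + Σ< M (λ j → firstAtMost s G (letter (suc j)))
        ≡⟨ cong (_+_ (preSum s G)) (Σ<-cong M λ j _ →
             cong (λ v → if does (v ≤? s) then G (letter (suc j)) else 0) (w-letter (suc j))) ⟩
      preSum s G + Σ< M (λ j → if does (suc j ≤? s) then G (letter (suc j)) else 0)
        ≡⟨ cong (_+_ (preSum s G)) (Σ<-truncate s≤M (λ j → G (letter (suc j)))) ⟩
      preSum s G + Σ< s (λ j → G (letter (suc j))) ∎

    preSum-zero : ∀ G → preSum 0 G ≡ 0
    preSum-zero G = trans (sum-map-cong-All (All.map (λ {x} pos →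
                      if-no (w x ≤? 0) (λ wx≤0 → n≮0 (≤-trans pos wx≤0))) pre-positive))
                    (sum-map-zero pre)

    wsum-weight-zero : ∀ M m g → wsum (alphabet M) m 0 g ≡ g []
    wsum-weight-zero M zero    g = trans (+-identityʳ _) (atWeight-zero-[] g)
    wsum-weight-zero M (suc m) g = begin
      wsum (alphabet M) (suc m) 0 g
        ≡⟨ wsum-suc (alphabet M) m 0 g ⟩
      atWeight 0 g [] + sum (map (firstAtMost 0 _) (alphabet M))
        ≡⟨ cong (_+_ (atWeight 0 g [])) (firstAtMost-alphabet z≤n _) ⟩
      atWeight 0 g [] + (preSum 0 _ + 0)
        ≡⟨ cong₂ _+_ (atWeight-zero-[] g) (trans (+-identityʳ _) (preSum-zero _)) ⟩
      g [] + 0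
        ≡⟨ +-identityʳ (g []) ⟩
      g [] ∎

    wsum-first-letter : ∀ {s M} m g → s ≤ M → wsum (alphabet M) (suc m) s g ≡
      atWeight s g [] + (preSum s (λ x → wsum (alphabet M) m (s ∸ w x) (λ l → g (x ∷ l)))
                         + Σ< s (λ j → wsum (alphabet M) m (s ∸ suc j) (λ l → g (letter (suc j) ∷ l))))
    wsum-first-letter {s} {M} m g s≤M =
      trans (wsum-suc (alphabet M) m s g) (cong (_+_ (atWeight s g []))
        (trans (firstAtMost-alphabet s≤M _) (cong (_+_ (preSum s _)) (Σ<-cong s λ j _ →
          cong (λ v → wsum (alphabet M) m (s ∸ v) (λ l → g (letter (suc j) ∷ l))) (w-letter (suc j))))))

    -- Words of weight s have length ≤ s and letters of weight ≤ s, so any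
    -- bounds m, M ≥ s give the same sum.
    wsum-bounds : ∀ {m m′ M M′ s} → s ≤ m → s ≤ m′ → s ≤ M → s ≤ M′ → ∀ g →
                  wsum (alphabet M) m s g ≡ wsum (alphabet M′) m′ s g
    wsum-bounds {m} {m′} {M} {M′} z≤n z≤n _ _ g =
      trans (wsum-weight-zero M m g) (sym (wsum-weight-zero M′ m′ g))
    wsum-bounds {suc m} {suc m′} {M} {M′} {suc s} (s≤s s≤m) (s≤s s≤m′) s<M s<M′ g = begin
      wsum (alphabet M) (suc m) (suc s) g
        ≡⟨ wsum-first-letter m g s<M ⟩
      atWeight (suc s) g [] + (preSum (suc s) (λ x → wsum (alphabet M) m (suc s ∸ w x) (λ l → g (x ∷ l)))
                               + Σ< (suc s) (λ j → wsum (alphabet M) m (s ∸ j) (λ l → g (letter (suc j) ∷ l))))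
        ≡⟨ cong (_+_ (atWeight (suc s) g [])) (cong₂ _+_ first-in-pre first-a-letter) ⟩
      atWeight (suc s) g [] + (preSum (suc s) (λ x → wsum (alphabet M′) m′ (suc s ∸ w x) (λ l → g (x ∷ l)))
                               + Σ< (suc s) (λ j → wsum (alphabet M′) m′ (s ∸ j) (λ l → g (letter (suc j) ∷ l))))
        ≡⟨ wsum-first-letter m′ g s<M′ ⟨
      wsum (alphabet M′) (suc m′) (suc s) g ∎
      where
      first-in-pre : preSum (suc s) (λ x → wsum (alphabet M) m (suc s ∸ w x) (λ l → g (x ∷ l)))
                   ≡ preSum (suc s) (λ x → wsum (alphabet M′) m′ (suc s ∸ w x) (λ l → g (x ∷ l)))
      first-in-pre = sum-map-cong-All (All.map (λ {x} pos → if-cong (w x ≤? suc s) λ _ →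
        wsum-bounds (weight-drop (s≤s s≤m) pos) (weight-drop (s≤s s≤m′) pos)
                    (≤-trans (m∸n≤m (suc s) (w x)) s<M) (≤-trans (m∸n≤m (suc s) (w x)) s<M′)
                    (λ l → g (x ∷ l))) pre-positive)
      first-a-letter : Σ< (suc s) (λ j → wsum (alphabet M) m (s ∸ j) (λ l → g (letter (suc j) ∷ l)))
                     ≡ Σ< (suc s) (λ j → wsum (alphabet M′) m′ (s ∸ j) (λ l → g (letter (suc j) ∷ l)))
      first-a-letter = Σ<-cong (suc s) λ j _ →
        wsum-bounds (≤-trans (m∸n≤m s j) s≤m) (≤-trans (m∸n≤m s j) s≤m′)
                    (≤-trans (m∸n≤m (suc s) (suc j)) s<M) (≤-trans (m∸n≤m (suc s) (suc j)) s<M′)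
                    (λ l → g (letter (suc j) ∷ l))

    total : ℕ → (List A → ℕ) → ℕ
    total s g = wsum (alphabet s) s s g

    total-zero : ∀ g → total 0 g ≡ g []
    total-zero g = wsum-weight-zero 0 0 g

    total-suc : ∀ s g → total (suc s) g ≡
      preSum (suc s) (λ x → total (suc s ∸ w x) (λ l → g (x ∷ l)))
      + Σ< (suc s) (λ j → total (s ∸ j) (λ l → g (letter (suc j) ∷ l)))
    total-suc s g = begin
      total (suc s) g
        ≡⟨ wsum-first-letter s g ≤-refl ⟩
      atWeight (suc s) g [] + (preSum (suc s) (λ x → wsum (alphabet (suc s)) s (suc s ∸ w x) (λ l → g (x ∷ l)))
                               + Σ< (suc s) (λ j → wsum (alphabet (suc s)) s (s ∸ j) (λ l → g (letter (suc j) ∷ l))))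
        ≡⟨ cong₂ _+_ (atWeight-suc-[] s g) (cong₂ _+_ first-in-pre first-a-letter) ⟩
      0 + (preSum (suc s) (λ x → total (suc s ∸ w x) (λ l → g (x ∷ l)))
           + Σ< (suc s) (λ j → total (s ∸ j) (λ l → g (letter (suc j) ∷ l)))) ∎
      where
      first-in-pre : preSum (suc s) (λ x → wsum (alphabet (suc s)) s (suc s ∸ w x) (λ l → g (x ∷ l)))
                   ≡ preSum (suc s) (λ x → total (suc s ∸ w x) (λ l → g (x ∷ l)))
      first-in-pre = sum-map-cong-All (All.map (λ {x} pos → if-cong (w x ≤? suc s) λ _ →
        wsum-bounds (weight-drop ≤-refl pos) ≤-refl (m∸n≤m (suc s) (w x)) ≤-refl (λ l → g (x ∷ l))) pre-positive)
      first-a-letter : Σ< (suc s) (λ j → wsum (alphabet (suc s)) s (s ∸ j) (λ l → g (letter (suc j) ∷ l)))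
                     ≡ Σ< (suc s) (λ j → total (s ∸ j) (λ l → g (letter (suc j) ∷ l)))
      first-a-letter = Σ<-cong (suc s) λ j _ →
        wsum-bounds (m∸n≤m s j) ≤-refl (≤-trans (m∸n≤m s j) (n≤1+n s)) ≤-refl (λ l → g (letter (suc j) ∷ l))

    total-cong : ∀ s {g g′ : List A → ℕ} → (∀ l → g l ≡ g′ l) → total s g ≡ total s g′
    total-cong s eq = sum-map-cong (listsUpTo (alphabet s) s) λ c → cong (if does (W c ≟ s) then_else 0) (eq c)

    total-+ : ∀ s g g′ → total s (λ l → g l + g′ l) ≡ total s g + total s g′
    total-+ s g g′ = trans (sum-map-cong (listsUpTo (alphabet s) s) (atWeight-+ s g g′))
                           (sum-map-+ (atWeight s g) (atWeight s g′) (listsUpTo (alphabet s) s))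

    total-if : ∀ s b g → total s (λ l → if b then g l else 0) ≡ (if b then total s g else 0)
    total-if s b g = trans (sum-map-cong (listsUpTo (alphabet s) s) (atWeight-if s b g))
                           (sum-map-if b (atWeight s g) (listsUpTo (alphabet s) s))

-- Compositions: words over the letters 1, 2, ... weighted by their value.
-- Comp.total n g is literally the sum of g over the list  compositions n.

module Comp = WordSums.Alphabet (λ x → x) sum refl (λ _ _ → refl) [] (λ j → j) (λ _ → refl) All.[]

R-as-total : ∀ n k → R n k ≡ Comp.total n (runs k)
R-as-total n k = sum-map-filter (λ c → sum c ≟ n) (runs k) (listsUpTo (map suc (upTo n)) n)

#comp : ℕ → ℕ
#comp s = Comp.total s (λ _ → 1)

δ₀ : ℕ → ℕ
δ₀ zero    = 1
δ₀ (suc _) = 0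

#comp-solves : Solves δ₀ #comp
#comp-solves zero    = Comp.total-zero (λ _ → 1)
#comp-solves (suc s) = trans (Comp.total-suc s (λ _ → 1)) (Σ<-reverse s #comp)

-- Tilings: words over red and white 1, white 2, ... weighted by length.

module Tiling = WordSums.Alphabet tileLength totalLength refl (λ _ _ → refl)
                  (red ∷ []) white (λ _ → refl) (s≤s z≤n All.∷ All.[])

tiling-suc : ∀ s g → Tiling.total (suc s) g ≡
  Tiling.total s (λ l → g (red ∷ l)) + Σ< (suc s) (λ j → Tiling.total (s ∸ j) (λ l → g (white (suc j) ∷ l)))
tiling-suc s g = trans (Tiling.total-suc s g)
  (cong (_+ Σ< (suc s) (λ j → Tiling.total (s ∸ j) (λ l → g (white (suc j) ∷ l))))
        (+-identityʳ (Tiling.total s (λ l → g (red ∷ l)))))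

noRed oneRed : List Tile → ℕ
noRed  ts = if does (redCount ts ≟ 0) then 1 else 0
oneRed ts = if does (redCount ts ≟ 1) then 1 else 0

-- Tilings without red squares are compositions.
noRed-solves : Solves δ₀ (λ s → Tiling.total s noRed)
noRed-solves zero    = Tiling.total-zero noRed
noRed-solves (suc s) = begin
  Tiling.total (suc s) noRed
    ≡⟨ tiling-suc s noRed ⟩
  Tiling.total s (λ _ → 0) + Σ< (suc s) (λ j → Tiling.total (s ∸ j) noRed)
    ≡⟨ cong₂ _+_ (Tiling.total-if s false (λ _ → 1)) (Σ<-reverse s (λ t → Tiling.total t noRed)) ⟩
  0 + Σ< (suc s) (λ t → Tiling.total t noRed) ∎

a1ℕ-as-total : ∀ N → a1ℕ N ≡ Tiling.total (suc N) oneRed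
a1ℕ-as-total N = begin
  length (tilings1 N)
    ≡⟨ length-as-sum (tilings1 N) ⟩
  sum (map (λ _ → 1) (tilings1 N))
    ≡⟨ sum-map-filter (λ t → redCount t ≟ 1) (λ _ → 1) (filter (λ t → totalLength t ≟ suc N) boards) ⟩
  sum (map oneRed (filter (λ t → totalLength t ≟ suc N) boards))
    ≡⟨ sum-map-filter (λ t → totalLength t ≟ suc N) oneRed boards ⟩
  Tiling.total (suc N) oneRed ∎
  where
  boards : List (List Tile)
  boards = listsUpTo (tilesFor (suc N)) (suc N)

-- a(1,s) = C s + a(1,s-1) + ... + a(1,0): the first tile is either the red
-- square, followed by a red-free tiling, or white.
a1ℕ-solves : Solves #comp a1ℕ
a1ℕ-solves s = begin
  a1ℕ s
    ≡⟨ a1ℕ-as-total s ⟩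
  Tiling.total (suc s) oneRed
    ≡⟨ tiling-suc s oneRed ⟩
  Tiling.total s noRed + Σ< (suc s) (λ j → Tiling.total (s ∸ j) oneRed)
    ≡⟨ cong₂ _+_ (solution-unique noRed-solves #comp-solves s) (Σ<-reverse s (λ t → Tiling.total t oneRed)) ⟩
  #comp s + (Tiling.total 0 oneRed + Σ< s (λ t → Tiling.total (suc t) oneRed))
    ≡⟨ cong (λ t → #comp s + (Tiling.total 0 oneRed + t)) (Σ<-cong s λ j _ → sym (a1ℕ-as-total j)) ⟩
  #comp s + (Tiling.total 0 oneRed + Σ< s a1ℕ)
    ≡⟨ cong (λ t → #comp s + (t + Σ< s a1ℕ)) (Tiling.total-zero oneRed) ⟩
  #comp s + Σ< s a1ℕ ∎

module Runs (k′ : ℕ) where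

  k : ℕ
  k = suc k′

  isK : ℕ → ℕ
  isK x = if does (x ≟ k) then 1 else 0

  startsWithK : List ℕ → ℕ
  startsWithK []      = 0
  startsWithK (x ∷ _) = isK x

  runs-∷ : ∀ x l → runs k (x ∷ l) ≡ isK x + runsFrom k (just x) l
  runs-∷ x l = cong (λ b → (if b then 1 else 0) + runsFrom k (just x) l) (isYes≗does (x ≟ k))

  -- After a part p, a leading k starts a new run unless p = k.
  runs-after : ∀ p l → runsFrom k (just p) l + (if does (p ≟ k) then startsWithK l else 0) ≡ runs k l
  runs-after p []      = if-eta (does (p ≟ k))
  runs-after p (x ∷ l) rewrite isYes≗does (p ≟ k) | isYes≗does (x ≟ k) with does (p ≟ k)
  ... | true  = +-comm (runsFrom k (just x) l) (isK x)
  ... | false = +-identityʳ (isK x + runsFrom k (just x) l)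

  A : ℕ → ℕ
  A s = Comp.total s (runs k)

  startsWithK-total : ∀ s → Comp.total s startsWithK ≡ shift k #comp s
  startsWithK-total zero    = Comp.total-zero startsWithK
  startsWithK-total (suc s) = begin
    Comp.total (suc s) startsWithK
      ≡⟨ Comp.total-suc s startsWithK ⟩
    Σ< (suc s) (λ j → Comp.total (s ∸ j) (λ _ → isK (suc j)))
      ≡⟨ Σ<-cong (suc s) (λ j _ → Comp.total-if (s ∸ j) (does (j ≟ k′)) (λ _ → 1)) ⟩
    Σ< (suc s) (λ j → if does (j ≟ k′) then #comp (s ∸ j) else 0)
      ≡⟨ Σ<-pick k′ s #comp ⟩
    shift k′ #comp s ∎

  A-suc : ∀ s → A (suc s) ≡ Σ< (suc s) (λ j → (if does (j ≟ k′) then #comp (s ∸ j) else 0)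
                                               + Comp.total (s ∸ j) (runsFrom k (just (suc j))))
  A-suc s = trans (Comp.total-suc s (runs k)) (Σ<-cong (suc s) λ j _ → begin
    Comp.total (s ∸ j) (λ l → runs k (suc j ∷ l))
      ≡⟨ Comp.total-cong (s ∸ j) (runs-∷ (suc j)) ⟩
    Comp.total (s ∸ j) (λ l → isK (suc j) + runsFrom k (just (suc j)) l)
      ≡⟨ Comp.total-+ (s ∸ j) (λ _ → isK (suc j)) (runsFrom k (just (suc j))) ⟩
    Comp.total (s ∸ j) (λ _ → isK (suc j)) + Comp.total (s ∸ j) (runsFrom k (just (suc j)))
      ≡⟨ cong (_+ Comp.total (s ∸ j) (runsFrom k (just (suc j))))
              (Comp.total-if (s ∸ j) (does (j ≟ k′)) (λ _ → 1)) ⟩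
    (if does (j ≟ k′) then #comp (s ∸ j) else 0) + Comp.total (s ∸ j) (runsFrom k (just (suc j))) ∎)

  runs-after-total : ∀ t p → Comp.total t (runsFrom k (just p))
                             + (if does (p ≟ k) then Comp.total t startsWithK else 0) ≡ A t
  runs-after-total t p = begin
    Comp.total t (runsFrom k (just p)) + (if does (p ≟ k) then Comp.total t startsWithK else 0)
      ≡⟨ cong (_+_ (Comp.total t (runsFrom k (just p)))) (Comp.total-if t (does (p ≟ k)) startsWithK) ⟨
    Comp.total t (runsFrom k (just p)) + Comp.total t (λ l → if does (p ≟ k) then startsWithK l else 0)
      ≡⟨ Comp.total-+ t (runsFrom k (just p)) _ ⟨
    Comp.total t (λ l → runsFrom k (just p) l + (if does (p ≟ k) then startsWithK l else 0))
      ≡⟨ Comp.total-cong t (runs-after p) ⟩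
    A t ∎

  shift-2k : ∀ s → shift (k + k) #comp (suc s)
                 ≡ Σ< (suc s) (λ j → if does (j ≟ k′) then Comp.total (s ∸ j) startsWithK else 0)
  shift-2k s = begin
    shift (k′ + k) #comp s
      ≡⟨ shift-shift k′ k #comp s ⟨
    shift k′ (shift k #comp) s
      ≡⟨ Σ<-pick k′ s (shift k #comp) ⟨
    Σ< (suc s) (λ j → if does (j ≟ k′) then shift k #comp (s ∸ j) else 0)
      ≡⟨ Σ<-cong (suc s) (λ j _ → cong (if does (j ≟ k′) then_else 0) (startsWithK-total (s ∸ j))) ⟨
    Σ< (suc s) (λ j → if does (j ≟ k′) then Comp.total (s ∸ j) startsWithK else 0) ∎

  -- The recurrence for R(·,k): A (s + 1) = C (s + 1 - k) + Σ_j (runs after a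
  -- first part j + 1), and the runs lost when j + 1 = k make up C (s + 1 - 2k).
  A-rec : ∀ s → A s + shift (k + k) #comp s ≡ shift k #comp s + Σ< s A
  A-rec zero    = cong (_+ 0) (Comp.total-zero (runs k))
  A-rec (suc s) = begin
    A (suc s) + shift (k + k) #comp (suc s)
      ≡⟨ cong₂ _+_ (A-suc s) (shift-2k s) ⟩
    Σ< (suc s) (λ j → leading j + after j) + Σ< (suc s) lost
      ≡⟨ cong (_+ Σ< (suc s) lost) (Σ<-+ (suc s) leading after) ⟩
    Σ< (suc s) leading + Σ< (suc s) after + Σ< (suc s) lost
      ≡⟨ +-assoc (Σ< (suc s) leading) _ _ ⟩
    Σ< (suc s) leading + (Σ< (suc s) after + Σ< (suc s) lost)
      ≡⟨ cong₂ _+_ (Σ<-pick k′ s #comp) (sym (Σ<-+ (suc s) after lost)) ⟩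
    shift k′ #comp s + Σ< (suc s) (λ j → after j + lost j)
      ≡⟨ cong (_+_ (shift k′ #comp s)) (Σ<-cong (suc s) λ j _ → runs-after-total (s ∸ j) (suc j)) ⟩
    shift k′ #comp s + Σ< (suc s) (λ j → A (s ∸ j))
      ≡⟨ cong (_+_ (shift k′ #comp s)) (Σ<-reverse s A) ⟩
    shift k #comp (suc s) + Σ< (suc s) A ∎
    where
    leading after lost : ℕ → ℕ
    leading j = if does (j ≟ k′) then #comp (s ∸ j) else 0
    after   j = Comp.total (s ∸ j) (runsFrom k (just (suc j)))
    lost    j = if does (j ≟ k′) then Comp.total (s ∸ j) startsWithK else 0

  runs-solves : Solves (shift k #comp) (λ s → A s + shift (k + k) a1ℕ s)
  runs-solves s = begin
    A s + shift (k + k) a1ℕ s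
      ≡⟨ cong (_+_ (A s)) (solves-shift (k + k) a1ℕ-solves s) ⟩
    A s + (shift (k + k) #comp s + Σ< s (shift (k + k) a1ℕ))
      ≡⟨ +-assoc (A s) _ _ ⟨
    A s + shift (k + k) #comp s + Σ< s (shift (k + k) a1ℕ)
      ≡⟨ cong (_+ Σ< s (shift (k + k) a1ℕ)) (A-rec s) ⟩
    shift k #comp s + Σ< s A + Σ< s (shift (k + k) a1ℕ)
      ≡⟨ +-assoc (shift k #comp s) _ _ ⟩
    shift k #comp s + (Σ< s A + Σ< s (shift (k + k) a1ℕ))
      ≡⟨ cong (_+_ (shift k #comp s)) (Σ<-+ s A (shift (k + k) a1ℕ)) ⟨
    shift k #comp s + Σ< s (λ t → A t + shift (k + k) a1ℕ t) ∎

  runs-formula : ∀ n → A n + shift (k + k) a1ℕ n ≡ shift k a1ℕ n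
  runs-formula = solution-unique runs-solves (solves-shift k a1ℕ-solves)

a1-minus : ∀ n j → a1 (+ n - + j) ≡ shift j a1ℕ n
a1-minus n j = trans (cong a1 (ℤ.m-n≡m⊖n n j)) (a1-⊖ n j)
  where
  a1-⊖ : ∀ n j → a1 (n ⊖ j) ≡ shift j a1ℕ n
  a1-⊖ n       zero    = cong a1 (ℤ.⊖-≥ {m = n} z≤n)
  a1-⊖ zero    (suc j) = refl
  a1-⊖ (suc n) (suc j) = trans (cong a1 (ℤ.[1+m]⊖[1+n]≡m⊖n n j)) (a1-⊖ n j)

two-k : ∀ k → + 2 * + k ≡ + (k + k)
two-k k = trans (sym (ℤ.pos-* 2 k)) (cong (λ t → + (k + t)) (+-identityʳ k))

+-minus : ∀ a b → + a ≡ + (a + b) - + b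
+-minus a b = sym (trans (ℤ.m-n≡m⊖n (a + b) b)
                         (trans (ℤ.⊖-≥ (m≤n+m b a)) (cong +_ (m+n∸n≡m a b))))

mainTheorem19 : (n k : ℕ) → .{{NonZero n}} → .{{NonZero k}} →
    + R n k ≡ + a1 (+ n - + k) - + a1 (+ n - + 2 * + k)
mainTheorem19 n (suc k′) = begin
  + R n k
    ≡⟨ cong +_ (R-as-total n k) ⟩
  + A n
    ≡⟨ +-minus (A n) (shift (k + k) a1ℕ n) ⟩
  + (A n + shift (k + k) a1ℕ n) - + shift (k + k) a1ℕ n
    ≡⟨ cong (λ t → + t - + shift (k + k) a1ℕ n) (runs-formula n) ⟩
  + shift k a1ℕ n - + shift (k + k) a1ℕ n
    ≡⟨ cong₂ (λ x y → + x - + y) (a1-minus n k) (trans (cong (λ t → a1 (+ n - t)) (two-k k)) (a1-minus n (k + k))) ⟨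
  + a1 (+ n - + k) - + a1 (+ n - + 2 * + k) ∎
  where open Runs k′
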